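{- Let $G \subseteq \mathrm{GL}_2(\hat{\mathbb{Z}})$ be a closed subgroup, let $\ell$ be a prime and let $\beta \in \mathbb{Z}_{\geq 0}$. Assume that for every integer $\gamma$ with $\beta \leq \gamma \leq \max\{\beta, \alpha_\ell\}$, \[ \ker(\pi_{\ell^{\gamma+1},\ell^{\gamma}}) \times \{1_{(\ell)}\} \subseteq (\pi_{\ell^\infty,\ell^{\gamma+1}} \times \mathrm{id}_{(\ell)})(G). \] Then $\ker(\pi_{\ell^\infty,\ell^\beta}) \times \{1_{(\ell)}\} \subseteq G$.
   Context: $\alpha_\ell := 2$ if $\ell = 2$ and $\alpha_\ell := 1$ if $\ell \geq 3$. Write $\mathbb{Z}_{(\ell)} := \prod_{p \neq \ell} \mathbb{Z}_p$, so $\mathrm{GL}_2(\hat{\mathbb{Z}}) \simeq \mathrm{GL}_2(\mathbb{Z}_\ell) \times \mathrm{GL}_2(\mathbb{Z}_{(\ell)})$; $1_{(\ell)}$ is the identity of $\mathrm{GL}_2(\mathbb{Z}_{(\ell)})$ and $\mathrm{id}_{(\ell)}$ the identity map on it. $\pi_{\ell^\infty,\ell^n}: \mathrm{GL}_2(\mathbb{Z}_\ell) \to \mathrm{GL}_2(\mathbb{Z}/\ell^n\mathbb{Z})$ and $\pi_{\ell^{n+1},\ell^n}: \mathrm{GL}_2(\mathbb{Z}/\ell^{n+1}\mathbb{Z}) \to \mathrm{GL}_2(\mathbb{Z}/\ell^n\mathbb{Z})$ are reduction maps, with the convention that $\mathrm{GL}_2(\mathbb{Z}/\ell^0\mathbb{Z})$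 is the trivial group (so $\ker \pi_{\ell,1} = \mathrm{GL}_2(\mathbb{Z}/\ell\mathbb{Z})$ and $\ker\pi_{\ell^\infty,1}=\mathrm{GL}_2(\mathbb{Z}_\ell)$). -}

module Defs where

open import Data.Nat as ℕ using (ℕ; NonZero; _^_; _+_)
open import Data.Integer as ℤ using (ℤ; +_; _-_; _*_)
open import Data.Integer.Divisibility as ℤD using ()
open import Data.Nat.Divisibility as ℕD using ()
open import Data.Nat.Coprimality using (Coprime)
open import Data.Product using (Σ; _×_; ∃; ∃-syntax)

infix 4 _≡_[mod_]
_≡_[mod_] : ℤ → ℤ → ℕ → Set
a ≡ b [mod n ] = (+ n) ℤD.∣ (a - b)

record M2 : Set where
  constructor mat2
  field
    a b c d : ℤ
open M2

infixl 7 _·_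
_·_ : M2 → M2 → M2
mat2 a₁ b₁ c₁ d₁ · mat2 a₂ b₂ c₂ d₂ =
  mat2 (a₁ * a₂ ℤ.+ b₁ * c₂) (a₁ * b₂ ℤ.+ b₁ * d₂)
       (c₁ * a₂ ℤ.+ d₁ * c₂) (c₁ * b₂ ℤ.+ d₁ * d₂)

I₂ : M2
I₂ = mat2 (+ 1) (+ 0) (+ 0) (+ 1)

det : M2 → ℤ
det (mat2 a b c d) = a * d - b * c

infix 4 _≡ₘ_[mod_]
_≡ₘ_[mod_] : M2 → M2 → ℕ → Set
A ≡ₘ B [mod n ] =
  (a A ≡ a B [mod n ]) × (b A ≡ b B [mod n ]) ×
  (c A ≡ c B [mod n ]) × (d A ≡ d B [mod n ])

InvMod : M2 → ℕ → Set
InvMod A n = ∃[ u ] (det A * u ≡ + 1 [mod n ])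

-- GL₂(Ẑ) = lim← GL₂(ℤ/nℤ): a compatible family of matrices A n
-- (meaningful modulo n, for n ≥ 1), each invertible modulo n.
record GL2Ẑ : Set where
  field
    lvl    : ℕ → M2
    compat : ∀ m n → NonZero m → n ℕD.∣ m → lvl m ≡ₘ lvl n [mod n ]
    inv    : ∀ n → NonZero n → InvMod (lvl n) n
open GL2Ẑ public

_≈_ : GL2Ẑ → GL2Ẑ → Set
g ≈ h = ∀ n → NonZero n → lvl g n ≡ₘ lvl h n [mod n ]

-- G is a closed subgroup of GL₂(Ẑ) (profinite topology: the sets
-- {y | y ≡ x mod n}, n ≥ 1, form a neighbourhood basis of x).
record IsClosedSubgroup (G : GL2Ẑ → Set) : Set where
  field
    resp    : ∀ g h → G g → g ≈ h → G h
    one     : ∃[ e ] (G e × (∀ n → NonZero n → lvl e n ≡ₘ I₂ [mod n ]))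
    mul     : ∀ g h → G g → G h →
              ∃[ p ] (G p × (∀ n → NonZero n → lvl p n ≡ₘ lvl g n · lvl h n [mod n ]))
    inverse : ∀ g → G g →
              ∃[ h ] (G h × (∀ n → NonZero n → lvl g n · lvl h n ≡ₘ I₂ [mod n ]))
    closed  : ∀ x → (∀ n → NonZero n → ∃[ g ] (G g × lvl g n ≡ₘ lvl x n [mod n ])) → G x

α : ℕ → ℕ
α 2 = 2
α _ = 1

-- Under GL₂(Ẑ) ≅ GL₂(ℤ_ℓ) × GL₂(ℤ_(ℓ)), the ℓ'-component of g is 1_(ℓ)
-- iff g ≡ 1 modulo every n ≥ 1 coprime to ℓ (CRT).
PrimeToℓTrivial : ℕ → GL2Ẑ → Set
PrimeToℓTrivial ℓ g = ∀ n → NonZero n → Coprime n ℓ → lvl g n ≡ₘ I₂ [mod n ]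

-- The ℓ-component of g reduced mod ℓ^k is the class of lvl g (ℓ^k) mod ℓ^k.

{-# OPTIONS --safe #-}
-- Let H = G ∩ (GL₂(ℤ_ℓ) × {1}).  For j ≥ α_ℓ the binomial theorem gives
-- (1 + ℓʲX)^ℓ ≡ 1 + ℓʲ⁺¹X (mod ℓʲ⁺²): the cubic and higher terms vanish since 3j ≥ j + 2, and the
-- quadratic term (ℓ choose 2)ℓ²ʲX² vanishes because ℓ ∣ (ℓ choose 2) for odd ℓ, resp. 2j ≥ j + 2 when
-- ℓ = 2 and j ≥ 2.  So if H maps onto the kernel of reduction from level ℓʲ⁺¹ to ℓʲ, taking ℓ-th powers
-- shows it maps onto the kernel one level higher, and the hypothesis for β ≤ γ ≤ max(β, α_ℓ) propagates
-- to every γ ≥ β.  Now let x ≡ 1 (mod ℓ^β) have trivial ℓ'-part.  By induction on k, x is congruent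
-- modulo ℓᵏ to some h ∈ H: correct h by a lift of x h⁻¹, which lies in the kernel of reduction mod ℓᵏ.
-- Since x and h are both trivial away from ℓ, the Chinese remainder theorem makes x congruent to an
-- element of H modulo every n ≥ 1, and x ∈ G because G is closed.
module Submission where

open import Defs
open import Data.Nat using (ℕ; _≤_; _⊔_; _^_; suc)
open import Data.Nat.Primality using (Prime)
open import Data.Product using (Σ; _×_; ∃; ∃-syntax)

import Data.Nat as ℕ
open import Data.Nat using (zero; NonZero; _<_; z≤n; s≤s)
import Data.Nat.Properties as ℕ
open import Data.Nat.Divisibility using (_∣_; divides; _∣?_)
import Data.Nat.Divisibility as ℕ
open import Data.Nat.Coprimality as Coprimality using (Coprime; coprime-divisor)
open import Data.Nat.Primality using (euclidsLemma; prime⇒irreducible; prime⇒nonZero; prime⇒nonTrivial)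
open import Data.Nat.Induction using (<-wellFounded)
open import Induction.WellFounded using (Acc; acc)
open import Data.Integer using (ℤ; +_; -_; _+_; _*_; _-_; 0ℤ; 1ℤ)
import Data.Integer.Properties as ℤ
import Data.Integer.Divisibility.Signed as ℤ∣
open import Data.Integer.Tactic.RingSolver using (solve-∀)
open import Data.Product using (_,_)
open import Data.Sum using (inj₁; inj₂)
open import Data.Empty using (⊥-elim)
open import Level using (0ℓ)
open import Relation.Binary.Bundles using (Setoid)
import Relation.Binary.Reasoning.Setoid as SetoidReasoning
open import Relation.Binary.PropositionalEquality
open import Relation.Nullary using (¬_; yes; no)

private variable
  d k m n o p : ℕ
  s x y u v z : ℤ
  A A′ B B′ X : M2

prime⇒1<p : Prime p → 1 < p
prime⇒1<p {p} p-prime = ℕ.nonTrivial⇒n>1 p {{prime⇒nonTrivial p-prime}}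

∤⇒coprime : Prime p → ¬ p ∣ m → Coprime m p
∤⇒coprime p-prime p∤m (d∣m , d∣p) with prime⇒irreducible p-prime d∣p
... | inj₁ d≡1  = d≡1
... | inj₂ refl = ⊥-elim (p∤m d∣m)

coprime-* : Coprime m n → Coprime m k → Coprime m (n ℕ.* k)
coprime-* m⊥n m⊥k (d∣m , d∣nk) =
  m⊥k (d∣m , coprime-divisor (λ (e∣d , e∣n) → m⊥n (ℕ.∣-trans e∣d d∣m , e∣n)) d∣nk)

coprime-^ : Coprime m n → ∀ k → Coprime m (n ^ k)
coprime-^ m⊥n zero    (_ , d∣1) = ℕ.∣1⇒≡1 d∣1
coprime-^ m⊥n (suc k) = coprime-* m⊥n (coprime-^ m⊥n k)

coprime⇒*∣ : Coprime m n → m ∣ o → n ∣ o → m ℕ.* n ∣ o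
coprime⇒*∣ {m} {n} m⊥n (divides q refl) n∣qm
  with divides r refl ← coprime-divisor (Coprimality.sym m⊥n) (subst (n ∣_) (ℕ.*-comm q m) n∣qm) =
  divides r (trans (ℕ.*-assoc r n m) (cong (r ℕ.*_) (ℕ.*-comm n m)))

prime-power-decomposition : Prime p → ∀ n → .{{NonZero n}} → ∃[ k ] ∃[ m ] (n ≡ p ^ k ℕ.* m × Coprime m p)
prime-power-decomposition {p} p-prime n = go n (<-wellFounded n)
  where
  instance
    p≢0 : NonZero p
    p≢0 = prime⇒nonZero p-prime
  go : ∀ n → .{{NonZero n}} → Acc _<_ n → ∃[ k ] ∃[ m ] (n ≡ p ^ k ℕ.* m × Coprime m p)
  go n (acc smaller) with p ∣? n
  ... | no p∤n = 0 , n , sym (ℕ.*-identityˡ n) , ∤⇒coprime p-prime p∤n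
  ... | yes (divides q refl)
    with k , m , q≡pᵏm , m⊥p ←
           go q {{ℕ.m*n≢0⇒m≢0 q}} (smaller (ℕ.m<m*n q p {{ℕ.m*n≢0⇒m≢0 q}} (prime⇒1<p p-prime))) =
    suc k , m , qp≡p¹⁺ᵏm , m⊥p
    where
    qp≡p¹⁺ᵏm : q ℕ.* p ≡ p ^ suc k ℕ.* m
    qp≡p¹⁺ᵏm = begin
      q ℕ.* p               ≡⟨ ℕ.*-comm q p ⟩
      p ℕ.* q               ≡⟨ cong (p ℕ.*_) q≡pᵏm ⟩
      p ℕ.* (p ^ k ℕ.* m)   ≡⟨ ℕ.*-assoc p (p ^ k) m ⟨
      p ^ suc k ℕ.* m       ∎
      where open ≡-Reasoning

^-monoʳ-∣ : ∀ p {a b} → a ≤ b → p ^ a ∣ p ^ b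
^-monoʳ-∣ p {b = b} z≤n       = ℕ.1∣ (p ^ b)
^-monoʳ-∣ p         (s≤s a≤b) = ℕ.*-monoʳ-∣ p (^-monoʳ-∣ p a≤b)

^∣^*^ : ∀ p {a} b c → a ≤ b ℕ.+ c → p ^ a ∣ p ^ b ℕ.* p ^ c
^∣^*^ p {a} b c a≤b+c = subst (p ^ a ∣_) (ℕ.^-distribˡ-+-* p b c) (^-monoʳ-∣ p a≤b+c)

α≥1 : ∀ p → 1 ≤ α p
α≥1 zero                = s≤s z≤n
α≥1 (suc zero)          = s≤s z≤n
α≥1 (suc (suc zero))    = s≤s z≤n
α≥1 (suc (suc (suc _))) = s≤s z≤n

binom₂ : ℕ → ℕ
binom₂ zero    = 0
binom₂ (suc i) = binom₂ i ℕ.+ i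

binom₂-*2 : ∀ i → binom₂ (suc i) ℕ.* 2 ≡ suc i ℕ.* i
binom₂-*2 zero    = refl
binom₂-*2 (suc i) = begin
  (binom₂ (suc i) ℕ.+ suc i) ℕ.* 2       ≡⟨ ℕ.*-distribʳ-+ 2 (binom₂ (suc i)) (suc i) ⟩
  binom₂ (suc i) ℕ.* 2 ℕ.+ suc i ℕ.* 2   ≡⟨ cong (ℕ._+ suc i ℕ.* 2) (binom₂-*2 i) ⟩
  suc i ℕ.* i ℕ.+ suc i ℕ.* 2            ≡⟨ ℕ.*-distribˡ-+ (suc i) i 2 ⟨
  suc i ℕ.* (i ℕ.+ 2)                    ≡⟨ cong (suc i ℕ.*_) (ℕ.+-comm i 2) ⟩
  suc i ℕ.* suc (suc i)                  ≡⟨ ℕ.*-comm (suc i) (suc (suc i)) ⟩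
  suc (suc i) ℕ.* suc i                  ∎
  where open ≡-Reasoning

odd-prime∣binom₂ : Prime p → p ≢ 2 → p ∣ binom₂ p
odd-prime∣binom₂ {suc k} p-prime p≢2
  with euclidsLemma (binom₂ (suc k)) 2 p-prime (divides k (trans (binom₂-*2 k) (ℕ.*-comm (suc k) k)))
... | inj₁ p∣binom₂ = p∣binom₂
... | inj₂ p∣2      = ⊥-elim (p≢2 (ℕ.≤-antisym (ℕ.∣⇒≤ p∣2) (prime⇒1<p p-prime)))

-- Unlike `_≡_[mod_]`, this record determines both sides by unification, and its quotient is explicit.
infix 4 _≡_⟨mod_⟩
record _≡_⟨mod_⟩ (x y : ℤ) (n : ℕ) : Set where
  constructor mod
  field
    quotient : ℤ
    equation : x ≡ y + + n * quotient

[mod]⇒⟨mod⟩ : x ≡ y [mod n ] → x ≡ y ⟨mod n ⟩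
[mod]⇒⟨mod⟩ {x} {y} {n} n∣x-y with ℤ∣.divides q x-y≡qn ← ℤ∣.∣ᵤ⇒∣ n∣x-y =
  mod q (trans (split x y) (cong (λ t → y + t) (trans x-y≡qn (ℤ.*-comm q (+ n)))))
  where split : ∀ x y → x ≡ y + (x - y)
        split = solve-∀

⟨mod⟩⇒[mod] : x ≡ y ⟨mod n ⟩ → x ≡ y [mod n ]
⟨mod⟩⇒[mod] {y = y} {n = n} (mod q refl) = ℤ∣.∣⇒∣ᵤ (ℤ∣.divides q (cancel y q (+ n)))
  where cancel : ∀ y q n → (y + n * q) - y ≡ q * n
        cancel = solve-∀

mod-reflexive : x ≡ y → x ≡ y ⟨mod n ⟩
mod-reflexive {x} {n = n} refl = mod 0ℤ (eq x (+ n))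
  where eq : ∀ x n → x ≡ x + n * 0ℤ
        eq = solve-∀

mod-refl : x ≡ x ⟨mod n ⟩
mod-refl = mod-reflexive refl

mod-sym : x ≡ y ⟨mod n ⟩ → y ≡ x ⟨mod n ⟩
mod-sym {y = y} {n = n} (mod q refl) = mod (- q) (eq y (+ n) q)
  where eq : ∀ y n q → y ≡ (y + n * q) + n * (- q)
        eq = solve-∀

mod-trans : x ≡ y ⟨mod n ⟩ → y ≡ z ⟨mod n ⟩ → x ≡ z ⟨mod n ⟩
mod-trans {n = n} {z = z} (mod q refl) (mod r refl) = mod (r + q) (eq z (+ n) q r)
  where eq : ∀ z n q r → (z + n * r) + n * q ≡ z + n * (r + q)
        eq = solve-∀

mod-+ : x ≡ y ⟨mod n ⟩ → u ≡ v ⟨mod n ⟩ → x + u ≡ y + v ⟨mod n ⟩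
mod-+ {y = y} {n = n} {v = v} (mod q refl) (mod r refl) = mod (q + r) (eq y v (+ n) q r)
  where eq : ∀ y v n q r → (y + n * q) + (v + n * r) ≡ (y + v) + n * (q + r)
        eq = solve-∀

mod-neg : x ≡ y ⟨mod n ⟩ → - x ≡ - y ⟨mod n ⟩
mod-neg {y = y} {n = n} (mod q refl) = mod (- q) (eq y (+ n) q)
  where eq : ∀ y n q → - (y + n * q) ≡ - y + n * (- q)
        eq = solve-∀

mod-* : x ≡ y ⟨mod n ⟩ → u ≡ v ⟨mod n ⟩ → x * u ≡ y * v ⟨mod n ⟩
mod-* {y = y} {n = n} {v = v} (mod q refl) (mod r refl) = mod (q * v + y * r + + n * q * r) (eq y v (+ n) q r)
  where eq : ∀ y v n q r → (y + n * q) * (v + n * r) ≡ y * v + n * (q * v + y * r + n * q * r)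
        eq = solve-∀

mod-∣ : d ∣ n → x ≡ y ⟨mod n ⟩ → x ≡ y ⟨mod d ⟩
mod-∣ {d} {y = y} (divides c refl) (mod q refl) =
  mod (+ c * q) (trans (cong (λ t → y + t * q) (ℤ.pos-* c d)) (eq y (+ c) (+ d) q))
  where eq : ∀ y c d q → y + c * d * q ≡ y + d * (c * q)
        eq = solve-∀

mod-scale : ∀ m → x ≡ y ⟨mod n ⟩ → + m * x ≡ + m * y ⟨mod m ℕ.* n ⟩
mod-scale {y = y} {n = n} m (mod q refl) =
  mod q (trans (eq (+ m) y (+ n) q) (cong (λ t → + m * y + t * q) (sym (ℤ.pos-* m n))))
  where eq : ∀ m y n q → m * (y + n * q) ≡ m * y + m * n * q
        eq = solve-∀

mod-*-0 : x ≡ 0ℤ ⟨mod m ⟩ → y ≡ 0ℤ ⟨mod n ⟩ → x * y ≡ 0ℤ ⟨mod m ℕ.* n ⟩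
mod-*-0 {m = m} {n = n} (mod q refl) (mod r refl) =
  mod (q * r) (trans (eq (+ m) (+ n) q r) (cong (λ t → 0ℤ + t * (q * r)) (sym (ℤ.pos-* m n))))
  where eq : ∀ m n q r → (0ℤ + m * q) * (0ℤ + n * r) ≡ 0ℤ + m * n * (q * r)
        eq = solve-∀

mod-crt : Coprime m n → x ≡ y ⟨mod m ⟩ → x ≡ y ⟨mod n ⟩ → x ≡ y ⟨mod m ℕ.* n ⟩
mod-crt m⊥n x≡y[m] x≡y[n] = [mod]⇒⟨mod⟩ (coprime⇒*∣ m⊥n (⟨mod⟩⇒[mod] x≡y[m]) (⟨mod⟩⇒[mod] x≡y[n]))

∣⇒≡0 : n ∣ m → + m ≡ 0ℤ ⟨mod n ⟩
∣⇒≡0 {n} (divides q refl) = mod (+ q) (trans (trans (ℤ.pos-* q n) (ℤ.*-comm (+ q) (+ n))) (sym (ℤ.+-identityˡ _)))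

infixl 6 _⊕_ _⊖_
infixr 7 _⊙_

_⊕_ : M2 → M2 → M2
mat2 a b c d ⊕ mat2 a′ b′ c′ d′ = mat2 (a + a′) (b + b′) (c + c′) (d + d′)

_⊖_ : M2 → M2 → M2
mat2 a b c d ⊖ mat2 a′ b′ c′ d′ = mat2 (a - a′) (b - b′) (c - c′) (d - d′)

_⊙_ : ℤ → M2 → M2
s ⊙ mat2 a b c d = mat2 (s * a) (s * b) (s * c) (s * d)

O₂ : M2
O₂ = mat2 0ℤ 0ℤ 0ℤ 0ℤ

pow : M2 → ℕ → M2
pow N zero    = I₂
pow N (suc i) = N · pow N i

mat2-cong : ∀ {a b c d a′ b′ c′ d′} → a ≡ a′ → b ≡ b′ → c ≡ c′ → d ≡ d′ → mat2 a b c d ≡ mat2 a′ b′ c′ d′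
mat2-cong refl refl refl refl = refl

·-assoc : ∀ A B C → (A · B) · C ≡ A · (B · C)
·-assoc (mat2 a b c d) (mat2 e f g h) (mat2 i j k l) =
  mat2-cong (entry a b e f g h i j k l) (entry a b e f g h j i l k)
            (entry c d e f g h i j k l) (entry c d e f g h j i l k)
  where entry : ∀ a b e f g h i j k l →
                (a * e + b * g) * i + (a * f + b * h) * k ≡ a * (e * i + f * k) + b * (g * i + h * k)
        entry = solve-∀

·-identityˡ : ∀ A → I₂ · A ≡ A
·-identityˡ (mat2 a b c d) = mat2-cong (top a c) (top b d) (bottom a c) (bottom b d)
  where top : ∀ a c → 1ℤ * a + 0ℤ * c ≡ a
        top = solve-∀
        bottom : ∀ a c → 0ℤ * a + 1ℤ * c ≡ c
        bottom = solve-∀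

·-identityʳ : ∀ A → A · I₂ ≡ A
·-identityʳ (mat2 a b c d) = mat2-cong (left a b) (right a b) (left c d) (right c d)
  where left : ∀ a b → a * 1ℤ + b * 0ℤ ≡ a
        left = solve-∀
        right : ∀ a b → a * 0ℤ + b * 1ℤ ≡ b
        right = solve-∀

det-· : ∀ A B → det (A · B) ≡ det A * det B
det-· (mat2 a b c d) (mat2 e f g h) = expand a b c d e f g h
  where expand : ∀ a b c d e f g h →
                 (a * e + b * g) * (c * f + d * h) - (a * f + b * h) * (c * e + d * g) ≡ (a * d - b * c) * (e * h - f * g)
        expand = solve-∀

⊕-identityʳ : ∀ A → A ⊕ O₂ ≡ A
⊕-identityʳ (mat2 a b c d) = mat2-cong (ℤ.+-identityʳ a) (ℤ.+-identityʳ b) (ℤ.+-identityʳ c) (ℤ.+-identityʳ d)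

I₂⊕[N⊖I₂] : ∀ N → I₂ ⊕ (N ⊖ I₂) ≡ N
I₂⊕[N⊖I₂] (mat2 a b c d) = mat2-cong (cancel 1ℤ a) (cancel 0ℤ b) (cancel 0ℤ c) (cancel 1ℤ d)
  where cancel : ∀ i a → i + (a - i) ≡ a
        cancel = solve-∀

[I₂⊕X]⊖I₂ : ∀ X → (I₂ ⊕ X) ⊖ I₂ ≡ X
[I₂⊕X]⊖I₂ (mat2 a b c d) = mat2-cong (cancel 1ℤ a) (cancel 0ℤ b) (cancel 0ℤ c) (cancel 1ℤ d)
  where cancel : ∀ i a → (i + a) - i ≡ a
        cancel = solve-∀

⊙-assoc : ∀ s t X → s ⊙ t ⊙ X ≡ (s * t) ⊙ X
⊙-assoc s t (mat2 a b c d) =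
  mat2-cong (sym (ℤ.*-assoc s t a)) (sym (ℤ.*-assoc s t b)) (sym (ℤ.*-assoc s t c)) (sym (ℤ.*-assoc s t d))

infix 4 _≋_⟨mod_⟩
record _≋_⟨mod_⟩ (A B : M2) (n : ℕ) : Set where
  constructor entrywise
  field
    ≡a : M2.a A ≡ M2.a B ⟨mod n ⟩
    ≡b : M2.b A ≡ M2.b B ⟨mod n ⟩
    ≡c : M2.c A ≡ M2.c B ⟨mod n ⟩
    ≡d : M2.d A ≡ M2.d B ⟨mod n ⟩

≡ₘ⇒≋ : A ≡ₘ B [mod n ] → A ≋ B ⟨mod n ⟩
≡ₘ⇒≋ (p , q , r , s) = entrywise ([mod]⇒⟨mod⟩ p) ([mod]⇒⟨mod⟩ q) ([mod]⇒⟨mod⟩ r) ([mod]⇒⟨mod⟩ s)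

≋⇒≡ₘ : A ≋ B ⟨mod n ⟩ → A ≡ₘ B [mod n ]
≋⇒≡ₘ (entrywise p q r s) = ⟨mod⟩⇒[mod] p , ⟨mod⟩⇒[mod] q , ⟨mod⟩⇒[mod] r , ⟨mod⟩⇒[mod] s

≋-reflexive : A ≡ B → A ≋ B ⟨mod n ⟩
≋-reflexive refl = entrywise mod-refl mod-refl mod-refl mod-refl

≋-refl : A ≋ A ⟨mod n ⟩
≋-refl = ≋-reflexive refl

≋-sym : A ≋ B ⟨mod n ⟩ → B ≋ A ⟨mod n ⟩
≋-sym (entrywise p q r s) = entrywise (mod-sym p) (mod-sym q) (mod-sym r) (mod-sym s)

≋-trans : A ≋ B ⟨mod n ⟩ → B ≋ X ⟨mod n ⟩ → A ≋ X ⟨mod n ⟩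
≋-trans (entrywise p q r s) (entrywise p′ q′ r′ s′) =
  entrywise (mod-trans p p′) (mod-trans q q′) (mod-trans r r′) (mod-trans s s′)

≋-setoid : ℕ → Setoid 0ℓ 0ℓ
≋-setoid n = record
  { Carrier       = M2
  ; _≈_           = λ A B → A ≋ B ⟨mod n ⟩
  ; isEquivalence = record { refl = ≋-refl ; sym = ≋-sym ; trans = ≋-trans }
  }

module ≋-Reasoning (n : ℕ) = SetoidReasoning (≋-setoid n)

≋-∣ : d ∣ n → A ≋ B ⟨mod n ⟩ → A ≋ B ⟨mod d ⟩
≋-∣ d∣n (entrywise p q r s) = entrywise (mod-∣ d∣n p) (mod-∣ d∣n q) (mod-∣ d∣n r) (mod-∣ d∣n s)

≋-crt : Coprime m n → A ≋ B ⟨mod m ⟩ → A ≋ B ⟨mod n ⟩ → A ≋ B ⟨mod m ℕ.* n ⟩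
≋-crt m⊥n (entrywise p q r s) (entrywise p′ q′ r′ s′) =
  entrywise (mod-crt m⊥n p p′) (mod-crt m⊥n q q′) (mod-crt m⊥n r r′) (mod-crt m⊥n s s′)

≋-· : A ≋ A′ ⟨mod n ⟩ → B ≋ B′ ⟨mod n ⟩ → A · B ≋ A′ · B′ ⟨mod n ⟩
≋-· {mat2 _ _ _ _} {mat2 _ _ _ _} {_} {mat2 _ _ _ _} {mat2 _ _ _ _} (entrywise p q r s) (entrywise p′ q′ r′ s′) =
  entrywise (mod-+ (mod-* p p′) (mod-* q r′)) (mod-+ (mod-* p q′) (mod-* q s′))
            (mod-+ (mod-* r p′) (mod-* s r′)) (mod-+ (mod-* r q′) (mod-* s s′))

≋-⊕ : A ≋ A′ ⟨mod n ⟩ → B ≋ B′ ⟨mod n ⟩ → A ⊕ B ≋ A′ ⊕ B′ ⟨mod n ⟩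
≋-⊕ {mat2 _ _ _ _} {mat2 _ _ _ _} {_} {mat2 _ _ _ _} {mat2 _ _ _ _} (entrywise p q r s) (entrywise p′ q′ r′ s′) =
  entrywise (mod-+ p p′) (mod-+ q q′) (mod-+ r r′) (mod-+ s s′)

≋-⊖ : A ≋ A′ ⟨mod n ⟩ → B ≋ B′ ⟨mod n ⟩ → A ⊖ B ≋ A′ ⊖ B′ ⟨mod n ⟩
≋-⊖ {mat2 _ _ _ _} {mat2 _ _ _ _} {_} {mat2 _ _ _ _} {mat2 _ _ _ _} (entrywise p q r s) (entrywise p′ q′ r′ s′) =
  entrywise (mod-+ p (mod-neg p′)) (mod-+ q (mod-neg q′)) (mod-+ r (mod-neg r′)) (mod-+ s (mod-neg s′))

≋-⊙ : ∀ s → A ≋ B ⟨mod n ⟩ → s ⊙ A ≋ s ⊙ B ⟨mod n ⟩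
≋-⊙ {mat2 _ _ _ _} {mat2 _ _ _ _} s (entrywise p q r t) =
  entrywise (mod-* (mod-refl {s}) p) (mod-* (mod-refl {s}) q) (mod-* (mod-refl {s}) r) (mod-* (mod-refl {s}) t)

≋-scale : ∀ m → A ≋ B ⟨mod n ⟩ → + m ⊙ A ≋ + m ⊙ B ⟨mod m ℕ.* n ⟩
≋-scale {mat2 _ _ _ _} {mat2 _ _ _ _} m (entrywise p q r s) =
  entrywise (mod-scale m p) (mod-scale m q) (mod-scale m r) (mod-scale m s)

≋-·-O : A ≋ O₂ ⟨mod m ⟩ → B ≋ O₂ ⟨mod n ⟩ → A · B ≋ O₂ ⟨mod m ℕ.* n ⟩
≋-·-O {mat2 _ _ _ _} {_} {mat2 _ _ _ _} (entrywise p q r s) (entrywise p′ q′ r′ s′) =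
  entrywise (mod-+ (mod-*-0 p p′) (mod-*-0 q r′)) (mod-+ (mod-*-0 p q′) (mod-*-0 q s′))
            (mod-+ (mod-*-0 r p′) (mod-*-0 s r′)) (mod-+ (mod-*-0 r q′) (mod-*-0 s s′))

≋-⊙-O : s ≡ 0ℤ ⟨mod m ⟩ → A ≋ O₂ ⟨mod n ⟩ → s ⊙ A ≋ O₂ ⟨mod m ℕ.* n ⟩
≋-⊙-O {A = mat2 _ _ _ _} s≡0 (entrywise p q r t) =
  entrywise (mod-*-0 s≡0 p) (mod-*-0 s≡0 q) (mod-*-0 s≡0 r) (mod-*-0 s≡0 t)

≋-⊙-Oʳ : ∀ s → A ≋ O₂ ⟨mod n ⟩ → s ⊙ A ≋ O₂ ⟨mod n ⟩
≋-⊙-Oʳ s A≋O = ≋-trans (≋-⊙ s A≋O) (≋-reflexive (cong (λ z → mat2 z z z z) (ℤ.*-zeroʳ s)))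

n⊙X≋O : ∀ n X → + n ⊙ X ≋ O₂ ⟨mod n ⟩
n⊙X≋O n (mat2 a b c d) = entrywise (multiple a) (multiple b) (multiple c) (multiple d)
  where multiple : ∀ x → + n * x ≡ 0ℤ ⟨mod n ⟩
        multiple x = mod x (sym (ℤ.+-identityˡ (+ n * x)))

≋⇒≡⊕⊙ : A ≋ B ⟨mod n ⟩ → ∃[ X ] A ≡ B ⊕ + n ⊙ X
≋⇒≡⊕⊙ {mat2 _ _ _ _} {mat2 _ _ _ _} (entrywise (mod q refl) (mod r refl) (mod s refl) (mod t refl)) =
  mat2 q r s t , refl

InvMod-∣ : d ∣ n → InvMod A n → InvMod A d
InvMod-∣ {A = A} d∣n (u , det·u≡1) = u , ⟨mod⟩⇒[mod] (mod-∣ d∣n ([mod]⇒⟨mod⟩ {det A * u} det·u≡1))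

InvMod-· : InvMod A n → InvMod B n → InvMod (A · B) n
InvMod-· {A} {n} {B} (u , detA·u≡1) (v , detB·v≡1) = u * v , ⟨mod⟩⇒[mod] (mod-trans (mod-reflexive regroup)
  (mod-* ([mod]⇒⟨mod⟩ {det A * u} detA·u≡1) ([mod]⇒⟨mod⟩ {det B * v} detB·v≡1)))
  where
  swap : ∀ a b c d → (a * b) * (c * d) ≡ (a * c) * (b * d)
  swap = solve-∀
  regroup : det (A · B) * (u * v) ≡ (det A * u) * (det B * v)
  regroup = trans (cong (_* (u * v)) (det-· A B)) (swap (det A) (det B) u v)

I₂⊕p⊙X-invertible : ∀ p X → InvMod (I₂ ⊕ + p ⊙ X) (p ℕ.* p)
I₂⊕p⊙X-invertible p (mat2 a b c d) = 1ℤ - + p * (a + d) , ⟨mod⟩⇒[mod] (mod w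
  (trans (expand (+ p) a b c d) (cong (λ q → 1ℤ + q * w) (sym (ℤ.pos-* p p)))))
  where
  w : ℤ
  w = (a * d - b * c) - (a + d) * (a + d) - + p * (a + d) * (a * d - b * c)
  expand : ∀ P a b c d →
    ((1ℤ + P * a) * (1ℤ + P * d) - (0ℤ + P * b) * (0ℤ + P * c)) * (1ℤ - P * (a + d))
    ≡ 1ℤ + (P * P) * ((a * d - b * c) - (a + d) * (a + d) - P * (a + d) * (a * d - b * c))
  expand = solve-∀

binomialExpansion : M2 → ℕ → M2
binomialExpansion M i = I₂ ⊕ + i ⊙ M ⊕ + binom₂ i ⊙ (M · M)

binomialExpansion-zero : ∀ M → binomialExpansion M 0 ≡ I₂
binomialExpansion-zero (mat2 a b c d) =
  mat2-cong (vanish 1ℤ a (a * a + b * c)) (vanish 0ℤ b (a * b + b * d))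
            (vanish 0ℤ c (c * a + d * c)) (vanish 1ℤ d (c * b + d * d))
  where vanish : ∀ i m q → (i + 0ℤ * m) + 0ℤ * q ≡ i
        vanish = solve-∀

binomialExpansion-suc : ∀ M i →
  (I₂ ⊕ M) · binomialExpansion M i ≡ binomialExpansion M (suc i) ⊕ + binom₂ i ⊙ (M · (M · M))
binomialExpansion-suc M i = step M (+ i) (+ binom₂ i)
  where
  step : ∀ M s t → (I₂ ⊕ M) · (I₂ ⊕ s ⊙ M ⊕ t ⊙ (M · M))
                   ≡ I₂ ⊕ (1ℤ + s) ⊙ M ⊕ (t + s) ⊙ (M · M) ⊕ t ⊙ (M · (M · M))
  step (mat2 a b c d) s t = mat2-cong (e₁₁ a b c d s t) (e₁₂ a b c d s t) (e₂₁ a b c d s t) (e₂₂ a b c d s t)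
    where
    e₁₁ : ∀ a b c d s t →
      (1ℤ + a) * ((1ℤ + s * a) + t * (a * a + b * c)) + (0ℤ + b) * ((0ℤ + s * c) + t * (c * a + d * c))
      ≡ ((1ℤ + (1ℤ + s) * a) + (t + s) * (a * a + b * c)) + t * (a * (a * a + b * c) + b * (c * a + d * c))
    e₁₁ = solve-∀
    e₁₂ : ∀ a b c d s t →
      (1ℤ + a) * ((0ℤ + s * b) + t * (a * b + b * d)) + (0ℤ + b) * ((1ℤ + s * d) + t * (c * b + d * d))
      ≡ ((0ℤ + (1ℤ + s) * b) + (t + s) * (a * b + b * d)) + t * (a * (a * b + b * d) + b * (c * b + d * d))
    e₁₂ = solve-∀
    e₂₁ : ∀ a b c d s t →
      (0ℤ + c) * ((1ℤ + s * a) + t * (a * a + b * c)) + (1ℤ + d) * ((0ℤ + s * c) + t * (c * a + d * c))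
      ≡ ((0ℤ + (1ℤ + s) * c) + (t + s) * (c * a + d * c)) + t * (c * (a * a + b * c) + d * (c * a + d * c))
    e₂₁ = solve-∀
    e₂₂ : ∀ a b c d s t →
      (0ℤ + c) * ((0ℤ + s * b) + t * (a * b + b * d)) + (1ℤ + d) * ((1ℤ + s * d) + t * (c * b + d * d))
      ≡ ((1ℤ + (1ℤ + s) * d) + (t + s) * (c * b + d * d)) + t * (c * (a * b + b * d) + d * (c * b + d * d))
    e₂₂ = solve-∀

pow-binomial : ∀ {M n} → M · (M · M) ≋ O₂ ⟨mod n ⟩ → ∀ i → pow (I₂ ⊕ M) i ≋ binomialExpansion M i ⟨mod n ⟩
pow-binomial {M} M³≋O zero    = ≋-reflexive (sym (binomialExpansion-zero M))
pow-binomial {M} {n} M³≋O (suc i) = begin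
  (I₂ ⊕ M) · pow (I₂ ⊕ M) i
    ≈⟨ ≋-· (≋-refl {I₂ ⊕ M}) (pow-binomial M³≋O i) ⟩
  (I₂ ⊕ M) · binomialExpansion M i
    ≡⟨ binomialExpansion-suc M i ⟩
  binomialExpansion M (suc i) ⊕ + binom₂ i ⊙ (M · (M · M))
    ≈⟨ ≋-⊕ (≋-refl {binomialExpansion M (suc i)}) (≋-⊙-Oʳ (+ binom₂ i) M³≋O) ⟩
  binomialExpansion M (suc i) ⊕ O₂
    ≡⟨ ⊕-identityʳ _ ⟩
  binomialExpansion M (suc i)
    ∎
  where open ≋-Reasoning n

pow-prime-lift : ∀ {p j} → Prime p → α p ≤ j → ∀ N X →
  N ≋ I₂ ⊕ + (p ^ j) ⊙ X ⟨mod p ^ suc j ⟩ → pow N p ≋ I₂ ⊕ + (p ^ suc j) ⊙ X ⟨mod p ^ suc (suc j) ⟩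
pow-prime-lift {p} {j} p-prime α≤j N X N≋ = begin
  pow N p                                    ≡⟨ cong (λ N → pow N p) (sym (I₂⊕[N⊖I₂] N)) ⟩
  pow (I₂ ⊕ M) p                             ≈⟨ pow-binomial M³≋O p ⟩
  I₂ ⊕ + p ⊙ M ⊕ + binom₂ p ⊙ (M · M)        ≈⟨ ≋-⊕ (≋-⊕ (≋-refl {I₂}) pM≋) binom₂M²≋O ⟩
  I₂ ⊕ + (p ^ suc j) ⊙ X ⊕ O₂                ≡⟨ ⊕-identityʳ _ ⟩
  I₂ ⊕ + (p ^ suc j) ⊙ X                     ∎
  where
  open ≋-Reasoning (p ^ suc (suc j))
  M : M2
  M = N ⊖ I₂
  1≤j : 1 ≤ j
  1≤j = ℕ.≤-trans (α≥1 p) α≤j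
  M≋ : M ≋ + (p ^ j) ⊙ X ⟨mod p ^ suc j ⟩
  M≋ = ≋-trans (≋-⊖ N≋ (≋-refl {I₂})) (≋-reflexive ([I₂⊕X]⊖I₂ _))
  M≋O : M ≋ O₂ ⟨mod p ^ j ⟩
  M≋O = ≋-trans (≋-∣ (ℕ.n∣m*n p) M≋) (n⊙X≋O (p ^ j) X)
  M²≋O : M · M ≋ O₂ ⟨mod p ^ (j ℕ.+ j) ⟩
  M²≋O = ≋-∣ (^∣^*^ p j j ℕ.≤-refl) (≋-·-O M≋O M≋O)
  M³≋O : M · (M · M) ≋ O₂ ⟨mod p ^ suc (suc j) ⟩
  M³≋O = ≋-∣ (^∣^*^ p j (j ℕ.+ j) 2+j≤3j) (≋-·-O M≋O M²≋O)
    where 2+j≤3j : 2 ℕ.+ j ≤ j ℕ.+ (j ℕ.+ j)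
          2+j≤3j = ℕ.≤-trans (ℕ.+-monoˡ-≤ j (ℕ.+-mono-≤ 1≤j 1≤j)) (ℕ.≤-reflexive (ℕ.+-comm (j ℕ.+ j) j))
  pM≋ : + p ⊙ M ≋ + (p ^ suc j) ⊙ X ⟨mod p ^ suc (suc j) ⟩
  pM≋ = ≋-trans (≋-scale p M≋)
          (≋-reflexive (trans (⊙-assoc (+ p) (+ (p ^ j)) X) (cong (_⊙ X) (sym (ℤ.pos-* p (p ^ j))))))
  binom₂M²≋O : + binom₂ p ⊙ (M · M) ≋ O₂ ⟨mod p ^ suc (suc j) ⟩
  -- This is where α enters: p ∣ binom₂ p for odd p, while for p = 2 we use 2j ≥ j + 2.
  binom₂M²≋O with p ℕ.≟ 2
  ... | yes refl = ≋-⊙-Oʳ (+ 1) (≋-∣ (^-monoʳ-∣ 2 (ℕ.+-monoˡ-≤ j α≤j)) M²≋O)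
  ... | no p≢2   = ≋-∣ (ℕ.*-monoʳ-∣ p (^-monoʳ-∣ p (ℕ.+-monoˡ-≤ j 1≤j)))
                        (≋-⊙-O (∣⇒≡0 (odd-prime∣binom₂ p-prime p≢2)) M²≋O)

lvl-∣ : ∀ g → NonZero m → n ∣ m → lvl g m ≋ lvl g n ⟨mod n ⟩
lvl-∣ {m} {n} g m≢0 n∣m = ≡ₘ⇒≋ {lvl g m} {lvl g n} (compat g m n m≢0 n∣m)

trivial⇒≋I₂ : ∀ g → PrimeToℓTrivial p g → NonZero n → Coprime n p → lvl g n ≋ I₂ ⟨mod n ⟩
trivial⇒≋I₂ {n = n} g g-trivial n≢0 n⊥p = ≡ₘ⇒≋ {lvl g n} {I₂} (g-trivial n n≢0 n⊥p)

module ClosedSubgroup {G : GL2Ẑ → Set} (G-closed : IsClosedSubgroup G) {ℓ : ℕ} (ℓ-prime : Prime ℓ) where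
  open IsClosedSubgroup G-closed

  instance
    ℓ≢0 : NonZero ℓ
    ℓ≢0 = prime⇒nonZero ℓ-prime

  lvl-^ : ∀ g {a b} → a ≤ b → lvl g (ℓ ^ b) ≋ lvl g (ℓ ^ a) ⟨mod ℓ ^ a ⟩
  lvl-^ g {b = b} a≤b = lvl-∣ g (ℕ.m^n≢0 ℓ b) (^-monoʳ-∣ ℓ a≤b)

  InImage : ℕ → M2 → Set
  InImage n A = ∃[ g ] (G g × lvl g n ≡ₘ A [mod n ] × PrimeToℓTrivial ℓ g)

  Approximable : GL2Ẑ → ℕ → Set
  Approximable x n = InImage n (lvl x n)

  record Represents (F : ℕ → M2) : Set where
    field
      elem    : GL2Ẑ
      ∈G      : G elem
      trivial : PrimeToℓTrivial ℓ elem
      ≋F      : ∀ n → NonZero n → lvl elem n ≋ F n ⟨mod n ⟩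

    inImage : ∀ {A} n → NonZero n → F n ≋ A ⟨mod n ⟩ → InImage n A
    inImage n n≢0 F≋A = elem , ∈G , ≋⇒≡ₘ (≋-trans (≋F n n≢0) F≋A) , trivial

  open Represents

  one-rep : Represents (λ _ → I₂)
  one-rep with e , e∈G , e≡I ← one =
    record { elem = e ; ∈G = e∈G ; trivial = λ n n≢0 _ → e≡I n n≢0
           ; ≋F = λ n n≢0 → ≡ₘ⇒≋ (e≡I n n≢0) }

  element-rep : ∀ {g} → G g → PrimeToℓTrivial ℓ g → Represents (lvl g)
  element-rep {g} g∈G g-trivial = record { elem = g ; ∈G = g∈G ; trivial = g-trivial ; ≋F = λ _ _ → ≋-refl }

  ·-rep : ∀ {F F′} → Represents F → Represents F′ → Represents (λ n → F n · F′ n)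
  ·-rep {F} {F′} r r′ with p , p∈G , p≡gh ← mul (elem r) (elem r′) (∈G r) (∈G r′) =
    record { elem = p ; ∈G = p∈G ; trivial = p-trivial ; ≋F = p≋FF′ }
    where
    p≋gh : ∀ n → NonZero n → lvl p n ≋ lvl (elem r) n · lvl (elem r′) n ⟨mod n ⟩
    p≋gh n n≢0 = ≡ₘ⇒≋ {lvl p n} (p≡gh n n≢0)
    p≋FF′ : ∀ n → NonZero n → lvl p n ≋ F n · F′ n ⟨mod n ⟩
    p≋FF′ n n≢0 = ≋-trans (p≋gh n n≢0) (≋-· (≋F r n n≢0) (≋F r′ n n≢0))
    p-trivial : PrimeToℓTrivial ℓ p
    p-trivial n n≢0 n⊥ℓ = ≋⇒≡ₘ (begin
      lvl p n                               ≈⟨ p≋gh n n≢0 ⟩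
      lvl (elem r) n · lvl (elem r′) n
        ≈⟨ ≋-· (trivial⇒≋I₂ (elem r) (trivial r) n≢0 n⊥ℓ) (trivial⇒≋I₂ (elem r′) (trivial r′) n≢0 n⊥ℓ) ⟩
      I₂ · I₂                               ∎)
      where open ≋-Reasoning n

  pow-rep : ∀ {g} → G g → PrimeToℓTrivial ℓ g → ∀ i → Represents (λ n → pow (lvl g n) i)
  pow-rep g∈G g-trivial zero    = one-rep
  pow-rep g∈G g-trivial (suc i) = ·-rep (element-rep g∈G g-trivial) (pow-rep g∈G g-trivial i)

  rightInverse : ∀ {g} → G g → PrimeToℓTrivial ℓ g →
    ∃[ h ] (G h × PrimeToℓTrivial ℓ h × (∀ n → NonZero n → lvl g n · lvl h n ≋ I₂ ⟨mod n ⟩))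
  rightInverse {g} g∈G g-trivial with h , h∈G , gh≡I ← inverse g g∈G =
    h , h∈G , h-trivial , (λ n n≢0 → ≡ₘ⇒≋ (gh≡I n n≢0))
    where
    h-trivial : PrimeToℓTrivial ℓ h
    h-trivial n n≢0 n⊥ℓ = ≋⇒≡ₘ (begin
      lvl h n             ≡⟨ ·-identityˡ (lvl h n) ⟨
      I₂ · lvl h n        ≈⟨ ≋-· (≋-sym (trivial⇒≋I₂ g g-trivial n≢0 n⊥ℓ)) (≋-refl {lvl h n}) ⟩
      lvl g n · lvl h n   ≈⟨ ≡ₘ⇒≋ {lvl g n · lvl h n} {I₂} (gh≡I n n≢0) ⟩
      I₂                  ∎)
      where open ≋-Reasoning n

  KernelLifts : ℕ → Set
  KernelLifts γ = ∀ A → InvMod A (ℓ ^ suc γ) → A ≡ₘ I₂ [mod ℓ ^ γ ] → InImage (ℓ ^ suc γ) A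

  pow-ℓ-image : ∀ {j} → α ℓ ≤ j → ∀ X →
    InImage (ℓ ^ suc j) (I₂ ⊕ + (ℓ ^ j) ⊙ X) → InImage (ℓ ^ suc (suc j)) (I₂ ⊕ + (ℓ ^ suc j) ⊙ X)
  pow-ℓ-image {j} α≤j X (g , g∈G , g≡I+ℓʲX , g-trivial) =
    inImage gˡ _ (ℕ.m^n≢0 ℓ (suc (suc j))) (pow-prime-lift ℓ-prime α≤j _ X g≋I+ℓʲX)
    where
    gˡ : Represents (λ n → pow (lvl g n) ℓ)
    gˡ = pow-rep g∈G g-trivial ℓ
    g≋I+ℓʲX : lvl g (ℓ ^ suc (suc j)) ≋ I₂ ⊕ + (ℓ ^ j) ⊙ X ⟨mod ℓ ^ suc j ⟩
    g≋I+ℓʲX = ≋-trans (lvl-^ g (ℕ.n≤1+n (suc j))) (≡ₘ⇒≋ {lvl g (ℓ ^ suc j)} g≡I+ℓʲX)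

  kernelLifts-suc : ∀ {j} → α ℓ ≤ j → KernelLifts j → KernelLifts (suc j)
  -- A ≡ 1 (mod ℓʲ⁺¹) is automatically invertible.
  kernelLifts-suc {j} α≤j lifts A _ A≡I with X , refl ← ≋⇒≡⊕⊙ (≡ₘ⇒≋ {A} {I₂} A≡I) =
    pow-ℓ-image α≤j X (lifts C C-invertible C≡I)
    where
    C : M2
    C = I₂ ⊕ + (ℓ ^ j) ⊙ X
    C-invertible : InvMod C (ℓ ^ suc j)
    C-invertible = InvMod-∣ {A = C} (^∣^*^ ℓ j j (ℕ.+-monoˡ-≤ j (ℕ.≤-trans (α≥1 ℓ) α≤j)))
                                    (I₂⊕p⊙X-invertible (ℓ ^ j) X)
    C≡I : C ≡ₘ I₂ [mod ℓ ^ j ]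
    C≡I = ≋⇒≡ₘ (begin
      I₂ ⊕ + (ℓ ^ j) ⊙ X   ≈⟨ ≋-⊕ (≋-refl {I₂}) (n⊙X≋O (ℓ ^ j) X) ⟩
      I₂ ⊕ O₂              ≡⟨ ⊕-identityʳ I₂ ⟩
      I₂                   ∎)
      where open ≋-Reasoning (ℓ ^ j)

  kernelLifts-≥ : ∀ {β} → (∀ γ → β ≤ γ → γ ≤ β ⊔ α ℓ → KernelLifts γ) → ∀ γ → β ≤ γ → KernelLifts γ
  kernelLifts-≥ lifts zero β≤0 = lifts zero β≤0 z≤n
  kernelLifts-≥ {β} lifts (suc j) β≤1+j with suc j ℕ.≤? β ⊔ α ℓ
  ... | yes 1+j≤β⊔α = lifts (suc j) β≤1+j 1+j≤β⊔α
  ... | no  1+j≰β⊔α =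
    kernelLifts-suc (ℕ.m⊔n≤o⇒n≤o β (α ℓ) β⊔α≤j) (kernelLifts-≥ lifts j (ℕ.m⊔n≤o⇒m≤o β (α ℓ) β⊔α≤j))
    where
    β⊔α≤j : β ⊔ α ℓ ≤ j
    β⊔α≤j = ℕ.≤-pred (ℕ.≰⇒> 1+j≰β⊔α)

  InImage-·ʳ : ∀ {n X h} → G h → PrimeToℓTrivial ℓ h → NonZero n → InImage n (X · lvl h n) → InImage n X
  InImage-·ʳ {n} {X} {h} h∈G h-trivial n≢0 (g , g∈G , g≡Xh , g-trivial)
    with h′ , h′∈G , h′-trivial , hh′≋I ← rightInverse h∈G h-trivial =
    inImage (·-rep (element-rep g∈G g-trivial) (element-rep h′∈G h′-trivial)) n n≢0 (begin
      lvl g n · lvl h′ n             ≈⟨ ≋-· (≡ₘ⇒≋ {lvl g n} g≡Xh) (≋-refl {lvl h′ n}) ⟩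
      (X · lvl h n) · lvl h′ n       ≡⟨ ·-assoc X (lvl h n) (lvl h′ n) ⟩
      X · (lvl h n · lvl h′ n)       ≈⟨ ≋-· (≋-refl {X}) (hh′≋I n n≢0) ⟩
      X · I₂                         ≡⟨ ·-identityʳ X ⟩
      X                              ∎)
    where open ≋-Reasoning n

  approximable-suc : ∀ {k} x → KernelLifts k → Approximable x (ℓ ^ k) → Approximable x (ℓ ^ suc k)
  approximable-suc {k} x lifts (h , h∈G , h≡x , h-trivial)
    with h′ , h′∈G , h′-trivial , hh′≋I ← rightInverse h∈G h-trivial =
    InImage-·ʳ h′∈G h′-trivial ℓ¹⁺ᵏ≢0 (lifts (lvl x (ℓ ^ suc k) · lvl h′ (ℓ ^ suc k)) xh′-invertible (≋⇒≡ₘ xh′≋I))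
    where
    ℓ¹⁺ᵏ≢0 : NonZero (ℓ ^ suc k)
    ℓ¹⁺ᵏ≢0 = ℕ.m^n≢0 ℓ (suc k)
    xh′-invertible : InvMod (lvl x (ℓ ^ suc k) · lvl h′ (ℓ ^ suc k)) (ℓ ^ suc k)
    xh′-invertible = InvMod-· {A = lvl x (ℓ ^ suc k)} (inv x _ ℓ¹⁺ᵏ≢0) (inv h′ _ ℓ¹⁺ᵏ≢0)
    xh′≋I : lvl x (ℓ ^ suc k) · lvl h′ (ℓ ^ suc k) ≋ I₂ ⟨mod ℓ ^ k ⟩
    xh′≋I = begin
      lvl x (ℓ ^ suc k) · lvl h′ (ℓ ^ suc k)   ≈⟨ ≋-· (lvl-^ x (ℕ.n≤1+n k)) (lvl-^ h′ (ℕ.n≤1+n k)) ⟩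
      lvl x (ℓ ^ k) · lvl h′ (ℓ ^ k)
        ≈⟨ ≋-· (≋-sym (≡ₘ⇒≋ {lvl h (ℓ ^ k)} h≡x)) (≋-refl {lvl h′ (ℓ ^ k)}) ⟩
      lvl h (ℓ ^ k) · lvl h′ (ℓ ^ k)           ≈⟨ hh′≋I (ℓ ^ k) (ℕ.m^n≢0 ℓ k) ⟩
      I₂                                       ∎
      where open ≋-Reasoning (ℓ ^ k)

  approximable-≤ : ∀ {β k} x → lvl x (ℓ ^ β) ≡ₘ I₂ [mod ℓ ^ β ] → k ≤ β → Approximable x (ℓ ^ k)
  approximable-≤ {β} {k} x x≡I k≤β = inImage one-rep (ℓ ^ k) (ℕ.m^n≢0 ℓ k) (≋-sym (begin
    lvl x (ℓ ^ k)     ≈⟨ ≋-sym (lvl-^ x k≤β) ⟩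
    lvl x (ℓ ^ β)     ≈⟨ ≋-∣ (^-monoʳ-∣ ℓ k≤β) (≡ₘ⇒≋ {lvl x (ℓ ^ β)} x≡I) ⟩
    I₂                ∎))
    where open ≋-Reasoning (ℓ ^ k)

  approximable-ℓ^ : ∀ {β} x → (∀ γ → β ≤ γ → KernelLifts γ) → lvl x (ℓ ^ β) ≡ₘ I₂ [mod ℓ ^ β ] →
    ∀ k → Approximable x (ℓ ^ k)
  approximable-ℓ^ {β} x lifts x≡I zero = approximable-≤ {β} x x≡I z≤n
  approximable-ℓ^ {β} x lifts x≡I (suc k) with suc k ℕ.≤? β
  ... | yes 1+k≤β = approximable-≤ {β} x x≡I 1+k≤β
  ... | no  1+k≰β = approximable-suc {k} x (lifts k (ℕ.≤-pred (ℕ.≰⇒> 1+k≰β))) (approximable-ℓ^ {β} x lifts x≡I k)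

  approximable-crt : ∀ x → PrimeToℓTrivial ℓ x → (∀ k → Approximable x (ℓ ^ k)) → ∀ n → NonZero n → Approximable x n
  approximable-crt x x-trivial approximable-ℓᵏ n n≢0
    with k , m , refl , m⊥ℓ ← prime-power-decomposition ℓ-prime n {{n≢0}}
    with h , h∈G , h≡x , h-trivial ← approximable-ℓᵏ k =
    h , h∈G , ≋⇒≡ₘ (≋-crt (Coprimality.sym (coprime-^ m⊥ℓ k)) h≋x[ℓᵏ] h≋x[m]) , h-trivial
    where
    m≢0 : NonZero m
    m≢0 = ℕ.m*n≢0⇒n≢0 (ℓ ^ k) {{n≢0}}
    h≋x[ℓᵏ] : lvl h (ℓ ^ k ℕ.* m) ≋ lvl x (ℓ ^ k ℕ.* m) ⟨mod ℓ ^ k ⟩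
    h≋x[ℓᵏ] = begin
      lvl h (ℓ ^ k ℕ.* m)   ≈⟨ lvl-∣ h n≢0 (ℕ.m∣m*n m) ⟩
      lvl h (ℓ ^ k)         ≈⟨ ≡ₘ⇒≋ {lvl h (ℓ ^ k)} h≡x ⟩
      lvl x (ℓ ^ k)         ≈⟨ ≋-sym (lvl-∣ x n≢0 (ℕ.m∣m*n m)) ⟩
      lvl x (ℓ ^ k ℕ.* m)   ∎
      where open ≋-Reasoning (ℓ ^ k)
    h≋x[m] : lvl h (ℓ ^ k ℕ.* m) ≋ lvl x (ℓ ^ k ℕ.* m) ⟨mod m ⟩
    h≋x[m] = begin
      lvl h (ℓ ^ k ℕ.* m)   ≈⟨ lvl-∣ h n≢0 (ℕ.n∣m*n (ℓ ^ k)) ⟩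
      lvl h m               ≈⟨ trivial⇒≋I₂ h h-trivial m≢0 m⊥ℓ ⟩
      I₂                    ≈⟨ ≋-sym (trivial⇒≋I₂ x x-trivial m≢0 m⊥ℓ) ⟩
      lvl x m               ≈⟨ ≋-sym (lvl-∣ x n≢0 (ℕ.n∣m*n (ℓ ^ k))) ⟩
      lvl x (ℓ ^ k ℕ.* m)   ∎
      where open ≋-Reasoning m

lemma3p1 : (G : GL2Ẑ → Set) → IsClosedSubgroup G → (ℓ : ℕ) → Prime ℓ → (β : ℕ) →
    (∀ γ → β ≤ γ → γ ≤ β ⊔ α ℓ →
      ∀ (A : M2) → InvMod A (ℓ ^ suc γ) → A ≡ₘ I₂ [mod ℓ ^ γ ] →
        ∃[ g ] (G g × lvl g (ℓ ^ suc γ) ≡ₘ A [mod ℓ ^ suc γ ] × PrimeToℓTrivial ℓ g)) →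
    ∀ (x : GL2Ẑ) → lvl x (ℓ ^ β) ≡ₘ I₂ [mod ℓ ^ β ] → PrimeToℓTrivial ℓ x → G x
lemma3p1 G G-closed ℓ ℓ-prime β lifts x x≡I x-trivial = closed x approximations
  where
  open IsClosedSubgroup G-closed using (closed)
  open ClosedSubgroup G-closed ℓ-prime
  approximations : ∀ n → NonZero n → ∃[ g ] (G g × lvl g n ≡ₘ lvl x n [mod n ])
  approximations n n≢0 =
    let g , g∈G , g≡x , _ = approximable-crt x x-trivial (approximable-ℓ^ {β} x (kernelLifts-≥ lifts) x≡I) n n≢0
    in  g , g∈G , g≡x
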